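{- Let $(G,\oplus)$ be a gyro-group and $S=\{s,t\}\subseteq G$ with $(S\rangle=G$ and $\langle s\rangle\cap\langle t\rangle=\{0\}$. Let $\Gamma$ be the $L$-$G$-graph $\Phi(G;S)$. Then $\Gamma$ is a simple graph, and its line graph $L(\Gamma)$ is isomorphic to the Cayley graph $\mathrm{Cay}(G,A)$, where $A=(\langle s\rangle\cup\langle t\rangle)\setminus\{0\}$.
   Context: A gyro-group is a set $G$ with a binary operation $\oplus$ such that: (G1) there is $0\in G$ with $0\oplus a=a$ for all $a$; (G2) for each $a$ there is $b$ with $b\oplus a=0$; (G3) for all $a,b$ there is an automorphism $\mathrm{gyr}[a,b]$ of $(G,\oplus)$ with $a\oplus(b\oplus c)=(a\oplus b)\oplus \mathrm{gyr}[a,b]c$ for all $c$; (G4) $\mathrm{gyr}[a,b]=\mathrm{gyr}[a\oplus b,b]$. $\langle s\rangle$ denotes the sub-gyro-group generated by $s$ (the elements $s,\ s\oplus s,\ (s\oplus s)\oplus s,\dots$ together with $0$). The left-generated set $(S\rangle$ is $\{s_n\oplus(\cdots\oplus(s_2\oplus s_1)\cdots)\mid n\ge1,\ s_i\in S\}$. For $r\in S$ let $g_r:x\mapsto r\oplus x$; its cycles $(r)\oplus x$ have underlying sets $\langle r\rangle\oplus x$. The $G$-graph $\Phi(G;S)$ has as vertices the cycles of $g_r$ for all $r\in S$ (disjoint union over $r$), and two distinct vertices $(r)\oplus x,(r')\oplus y$ are joined by $p$ edges where $p=|\langle r\rangle\oplus x\cap\langle r'\rangle\oplus y|\ge1$;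 it is called the $L$-$G$-graph when $(S\rangle=G$. The line graph $L(\Gamma)$ of a simple graph $\Gamma$ has the edges of $\Gamma$ as vertices, two being adjacent iff the edges share an endpoint. $\mathrm{Cay}(G,A)$ is the graph with vertex set $G$ in which distinct $u,v$ are adjacent iff $v=a\oplus u$ for some $a\in A$. -}

module Defs where

open import Data.Nat using (ℕ; zero; suc)
open import Data.Bool using (Bool; true; false)
open import Data.Fin using (Fin)
open import Data.Product using (Σ; ∃; _×_; _,_; proj₁; proj₂)
open import Data.Sum using (_⊎_)
open import Data.List using (List; []; _∷_)
open import Data.List.Relation.Unary.All using (All)
open import Relation.Nullary using (¬_)
open import Relation.Binary.PropositionalEquality using (_≡_)
open import Function.Definitions using (Bijective)
open import Function.Bundles using (_↔_; _⇔_)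

record Gyrogroup : Set₁ where
  infixl 6 _⊕_
  field
    Carrier : Set
    _⊕_     : Carrier → Carrier → Carrier
    𝟘       : Carrier
    identityˡ : ∀ a → 𝟘 ⊕ a ≡ a
    inverseˡ  : ∀ a → ∃ λ b → b ⊕ a ≡ 𝟘
    gyr       : Carrier → Carrier → Carrier → Carrier
    gyr-hom   : ∀ a b x y → gyr a b (x ⊕ y) ≡ gyr a b x ⊕ gyr a b y
    gyr-bij   : ∀ a b → Bijective _≡_ _≡_ (gyr a b)
    gyroassoc : ∀ a b c → a ⊕ (b ⊕ c) ≡ (a ⊕ b) ⊕ gyr a b c
    loopˡ     : ∀ a b c → gyr a b c ≡ gyr (a ⊕ b) b c

Finite : Set → Set
Finite A = Σ ℕ λ n → A ↔ Fin n

module _ (G : Gyrogroup) where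
  open Gyrogroup G

  pow : Carrier → ℕ → Carrier
  pow s zero    = 𝟘
  pow s (suc k) = pow s k ⊕ s

  _∈⟨_⟩ : Carrier → Carrier → Set
  a ∈⟨ s ⟩ = ∃ λ k → pow s k ≡ a

  -- Left-generated set (S⟩ for S = {s,t}:
  -- s_n ⊕ (⋯ ⊕ (s_2 ⊕ s_1)⋯), the list being s_n ∷ ⋯ ∷ s_1 (n ≥ 1).
  leftProd : Carrier → List Carrier → Carrier
  leftProd x []       = x
  leftProd x (y ∷ ys) = x ⊕ leftProd y ys

  InPair : Carrier → Carrier → Carrier → Set
  InPair s t x = x ≡ s ⊎ x ≡ t

  LeftGenerates₂ : Carrier → Carrier → Set
  LeftGenerates₂ s t =
    ∀ g → Σ Carrier λ x → Σ (List Carrier) λ xs →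
      InPair s t x × All (InPair s t) xs × leftProd x xs ≡ g

  gen : Carrier → Carrier → Bool → Carrier
  gen s t true  = s
  gen s t false = t

  iter : Carrier → ℕ → Carrier → Carrier
  iter r zero    x = x
  iter r (suc k) x = r ⊕ iter r k x

  module Φ (s t : Carrier) where
    -- a vertex is a cycle (r) ⊕ x of g_r, r ∈ {s,t}, given by a tag and
    -- a representative point x
    Vertex : Set
    Vertex = Bool × Carrier

    _∈V_ : Carrier → Vertex → Set
    z ∈V (b , x) = ∃ λ k → iter (gen s t b) k x ≡ z

    _≈V_ : Vertex → Vertex → Set
    (b , x) ≈V (b' , y) = b ≡ b' × y ∈V (b , x)

    -- Γ is simple: no loops by construction; between distinct vertices
    -- the number p of common points is at most 1
    Simple : Set
    Simple = ∀ u v → ¬ (u ≈V v) → ∀ z z' →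
      z ∈V u → z ∈V v → z' ∈V u → z' ∈V v → z ≡ z'

    record Edge : Set where
      constructor edge
      field
        end₁ end₂ : Vertex
        distinct  : ¬ (end₁ ≈V end₂)
        shared    : ∃ λ z → z ∈V end₁ × z ∈V end₂
    open Edge public

    _≈E_ : Edge → Edge → Set
    e ≈E e' = (end₁ e ≈V end₁ e' × end₂ e ≈V end₂ e')
            ⊎ (end₁ e ≈V end₂ e' × end₂ e ≈V end₁ e')

    LAdj : Edge → Edge → Set
    LAdj e e' = ¬ (e ≈E e') ×
      (  end₁ e ≈V end₁ e' ⊎ end₁ e ≈V end₂ e'
       ⊎ end₂ e ≈V end₁ e' ⊎ end₂ e ≈V end₂ e')

    InA : Carrier → Set
    InA a = (a ∈⟨ s ⟩ ⊎ a ∈⟨ t ⟩) × ¬ (a ≡ 𝟘)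

    CayAdj : Carrier → Carrier → Set
    CayAdj u v = ¬ (u ≡ v) × ∃ λ a → InA a × v ≡ a ⊕ u

    record CayIsoL : Set where
      field
        f         : Carrier → Edge
        injective : ∀ x y → f x ≈E f y → x ≡ y
        surjective : ∀ e → ∃ λ x → f x ≈E e
        adjacency : ∀ x y → CayAdj x y ⇔ LAdj (f x) (f y)

-- Each map g_r : x ↦ r ⊕ x is a permutation of the finite set G, and its cycles are the
-- cosets ⟨r⟩ ⊕ x, since g_r^k x = pow r k ⊕ x (the gyration gyr[pow r k, r] is trivial by the
-- left loop property). If z and z' = a ⊕ z = b ⊕ z with a ∈ ⟨s⟩, b ∈ ⟨t⟩ lie on a common
-- s-cycle and a common t-cycle, right cancellation gives a = b ∈ ⟨s⟩ ∩ ⟨t⟩ = {0}, so z = z'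
-- and Γ is simple. Cycles of the same generator are disjoint or equal, so the edges of Γ are
-- exactly the points x ∈ G (joining the s-cycle and the t-cycle through x), and two of them
-- share a cycle iff they differ by a nonzero element of ⟨s⟩ or of ⟨t⟩: adjacency in Cay(G, A).
module Submission where

open import Defs
open import Data.Bool using (true; false)
open import Data.Bool.Properties using (_≟_)
open import Data.Nat using (ℕ; zero; suc; _+_; _*_; _<_)
open import Data.Nat.Properties using (n<1+n; m≤n⇒∃[o]m+o≡n; +-suc; +-comm; *-suc)
open import Data.Fin using (toℕ)
open import Data.Fin.Properties using (pigeonhole)
open import Data.Product using (_×_; _,_; proj₁; proj₂; ∃; ∃₂)
open import Data.Sum using (_⊎_; inj₁; inj₂)
open import Function.Base using (_∘_)
open import Function.Bundles using (Inverse; Injection; Equivalence; _⇔_; mk⇔)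
open import Function.Properties.Inverse using (↔⇒↣)
open import Relation.Nullary using (¬_; yes; no; contradiction)
open import Relation.Binary.PropositionalEquality

finite-pigeonhole : ∀ {A : Set} → Finite A → (f : ℕ → A) → ∃₂ λ i j → i < j × f i ≡ f j
finite-pigeonhole (n , φ) f
  with i , j , i<j , eq ← pigeonhole (n<1+n n) (Inverse.to φ ∘ f ∘ toℕ)
  = toℕ i , toℕ j , i<j , Injection.injective (↔⇒↣ φ) eq

module GyrogroupProperties (G : Gyrogroup) where
  open Gyrogroup G
  open ≡-Reasoning

  infix 8 ⊖_
  ⊖_ : Carrier → Carrier
  ⊖ a = proj₁ (inverseˡ a)

  ⊖-inverseˡ : ∀ a → ⊖ a ⊕ a ≡ 𝟘
  ⊖-inverseˡ a = proj₂ (inverseˡ a)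

  gyr-injective : ∀ a b {x y} → gyr a b x ≡ gyr a b y → x ≡ y
  gyr-injective a b = proj₁ (gyr-bij a b)

  ⊕-cancelˡ : ∀ a {b c} → a ⊕ b ≡ a ⊕ c → b ≡ c
  ⊕-cancelˡ a {b} {c} eq = gyr-injective (⊖ a) a (begin
    gyr (⊖ a) a b                    ≡⟨ sym (identityˡ _) ⟩
    𝟘 ⊕ gyr (⊖ a) a b                ≡⟨ cong (_⊕ gyr (⊖ a) a b) (sym (⊖-inverseˡ a)) ⟩
    (⊖ a ⊕ a) ⊕ gyr (⊖ a) a b        ≡⟨ sym (gyroassoc (⊖ a) a b) ⟩
    ⊖ a ⊕ (a ⊕ b)                    ≡⟨ cong (⊖ a ⊕_) eq ⟩
    ⊖ a ⊕ (a ⊕ c)                    ≡⟨ gyroassoc (⊖ a) a c ⟩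
    (⊖ a ⊕ a) ⊕ gyr (⊖ a) a c        ≡⟨ cong (_⊕ gyr (⊖ a) a c) (⊖-inverseˡ a) ⟩
    𝟘 ⊕ gyr (⊖ a) a c                ≡⟨ identityˡ _ ⟩
    gyr (⊖ a) a c                    ∎)

  gyr-𝟘ˡ : ∀ a c → gyr 𝟘 a c ≡ c
  gyr-𝟘ˡ a c = sym (⊕-cancelˡ a (begin
    a ⊕ c                  ≡⟨ sym (identityˡ _) ⟩
    𝟘 ⊕ (a ⊕ c)            ≡⟨ gyroassoc 𝟘 a c ⟩
    (𝟘 ⊕ a) ⊕ gyr 𝟘 a c    ≡⟨ cong (_⊕ gyr 𝟘 a c) (identityˡ a) ⟩
    a ⊕ gyr 𝟘 a c          ∎))

  gyr-⊖ˡ : ∀ a c → gyr (⊖ a) a c ≡ c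
  gyr-⊖ˡ a c = begin
    gyr (⊖ a) a c        ≡⟨ loopˡ (⊖ a) a c ⟩
    gyr (⊖ a ⊕ a) a c    ≡⟨ cong (λ w → gyr w a c) (⊖-inverseˡ a) ⟩
    gyr 𝟘 a c            ≡⟨ gyr-𝟘ˡ a c ⟩
    c                    ∎

  ⊖-⊕-cancel : ∀ a c → ⊖ a ⊕ (a ⊕ c) ≡ c
  ⊖-⊕-cancel a c = begin
    ⊖ a ⊕ (a ⊕ c)              ≡⟨ gyroassoc (⊖ a) a c ⟩
    (⊖ a ⊕ a) ⊕ gyr (⊖ a) a c  ≡⟨ cong₂ _⊕_ (⊖-inverseˡ a) (gyr-⊖ˡ a c) ⟩
    𝟘 ⊕ c                      ≡⟨ identityˡ c ⟩
    c                          ∎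

  identityʳ : ∀ a → a ⊕ 𝟘 ≡ a
  identityʳ a = ⊕-cancelˡ (⊖ a) (trans (⊖-⊕-cancel a 𝟘) (sym (⊖-inverseˡ a)))

  ⊖-inverseʳ : ∀ a → a ⊕ ⊖ a ≡ 𝟘
  ⊖-inverseʳ a = ⊕-cancelˡ (⊖ a) (trans (⊖-⊕-cancel a (⊖ a)) (sym (identityʳ (⊖ a))))

  ⊕-gyr-⊖-cancelʳ : ∀ a b → (a ⊕ b) ⊕ gyr (a ⊕ b) b (⊖ b) ≡ a
  ⊕-gyr-⊖-cancelʳ a b = begin
    (a ⊕ b) ⊕ gyr (a ⊕ b) b (⊖ b)  ≡⟨ cong ((a ⊕ b) ⊕_) (sym (loopˡ a b (⊖ b))) ⟩
    (a ⊕ b) ⊕ gyr a b (⊖ b)        ≡⟨ sym (gyroassoc a b (⊖ b)) ⟩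
    a ⊕ (b ⊕ ⊖ b)                  ≡⟨ cong (a ⊕_) (⊖-inverseʳ b) ⟩
    a ⊕ 𝟘                          ≡⟨ identityʳ a ⟩
    a                              ∎

  ⊕-cancelʳ : ∀ a b c → a ⊕ c ≡ b ⊕ c → a ≡ b
  ⊕-cancelʳ a b c eq = begin
    a                              ≡⟨ sym (⊕-gyr-⊖-cancelʳ a c) ⟩
    (a ⊕ c) ⊕ gyr (a ⊕ c) c (⊖ c)  ≡⟨ cong (λ w → w ⊕ gyr w c (⊖ c)) eq ⟩
    (b ⊕ c) ⊕ gyr (b ⊕ c) c (⊖ c)  ≡⟨ ⊕-gyr-⊖-cancelʳ b c ⟩
    b                              ∎

  gyr-pow : ∀ r k c → gyr (pow G r k) r c ≡ c
  gyr-pow r zero    c = gyr-𝟘ˡ r c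
  gyr-pow r (suc k) c = trans (sym (loopˡ (pow G r k) r c)) (gyr-pow r k c)

  iter-+ : ∀ r i j x → iter G r i (iter G r j x) ≡ iter G r (i + j) x
  iter-+ r zero    j x = refl
  iter-+ r (suc i) j x = cong (r ⊕_) (iter-+ r i j x)

  iter-pow : ∀ r k x → iter G r k x ≡ pow G r k ⊕ x
  iter-pow r zero    x = sym (identityˡ x)
  iter-pow r (suc k) x = begin
    iter G r (suc k) x                     ≡⟨ cong (λ n → iter G r n x) (sym (+-comm k 1)) ⟩
    iter G r (k + 1) x                     ≡⟨ sym (iter-+ r k 1 x) ⟩
    iter G r k (r ⊕ x)                     ≡⟨ iter-pow r k (r ⊕ x) ⟩
    pow G r k ⊕ (r ⊕ x)                    ≡⟨ gyroassoc (pow G r k) r x ⟩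
    pow G r (suc k) ⊕ gyr (pow G r k) r x  ≡⟨ cong (pow G r (suc k) ⊕_) (gyr-pow r k x) ⟩
    pow G r (suc k) ⊕ x                    ∎

  iter-injective : ∀ r k {x y} → iter G r k x ≡ iter G r k y → x ≡ y
  iter-injective r zero    eq = eq
  iter-injective r (suc k) eq = iter-injective r k (⊕-cancelˡ r eq)

  iter-periodic : Finite Carrier → ∀ r x → ∃ λ p → iter G r (suc p) x ≡ x
  iter-periodic finite r x
    with i , j , i<j , eq ← finite-pigeonhole finite (λ k → iter G r k x)
    with p , refl ← m≤n⇒∃[o]m+o≡n i<j
    = p , sym (iter-injective r i (begin
      iter G r i x                    ≡⟨ eq ⟩
      iter G r (suc i + p) x          ≡⟨ cong (λ n → iter G r n x) (sym (+-suc i p)) ⟩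
      iter G r (i + suc p) x          ≡⟨ sym (iter-+ r i (suc p) x) ⟩
      iter G r i (iter G r (suc p) x) ∎))

  iter-multiple : ∀ r q {x} → iter G r q x ≡ x → ∀ n → iter G r (n * q) x ≡ x
  iter-multiple r q     eq zero    = refl
  iter-multiple r q {x} eq (suc n) = begin
    iter G r (q + n * q) x           ≡⟨ sym (iter-+ r q (n * q) x) ⟩
    iter G r q (iter G r (n * q) x)  ≡⟨ cong (iter G r q) (iter-multiple r q eq n) ⟩
    iter G r q x                     ≡⟨ eq ⟩
    x                                ∎

  Orbit : Carrier → Carrier → Carrier → Set
  Orbit r x y = ∃ λ k → iter G r k x ≡ y

  orbit-refl : ∀ {r x} → Orbit r x x
  orbit-refl = 0 , refl

  orbit-trans : ∀ {r x y z} → Orbit r x y → Orbit r y z → Orbit r x z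
  orbit-trans {r} {x} (i , refl) (j , refl) = j + i , sym (iter-+ r j i x)

  orbit-sym : Finite Carrier → ∀ {r x y} → Orbit r x y → Orbit r y x
  orbit-sym finite {r} {x} (k , refl) with p , periodic ← iter-periodic finite r x
    = k * p , (begin
      iter G r (k * p) (iter G r k x)  ≡⟨ iter-+ r (k * p) k x ⟩
      iter G r (k * p + k) x           ≡⟨ cong (λ n → iter G r n x) (+-comm (k * p) k) ⟩
      iter G r (k + k * p) x           ≡⟨ cong (λ n → iter G r n x) (sym (*-suc k p)) ⟩
      iter G r (k * suc p) x           ≡⟨ iter-multiple r (suc p) periodic k ⟩
      x                                ∎)

  orbit-within : Finite Carrier → ∀ {r x z z'} → Orbit r x z → Orbit r x z' → Orbit r z z'
  orbit-within finite zx z'x = orbit-trans (orbit-sym finite zx) z'x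

  orbit⇔coset : ∀ {r x y} → Orbit r x y ⇔ ∃ λ a → _∈⟨_⟩ G a r × y ≡ a ⊕ x
  orbit⇔coset {r} {x} = mk⇔
    (λ (k , eq) → pow G r k , (k , refl) , trans (sym eq) (iter-pow r k x))
    (λ (a , (k , pk) , eq) → k , trans (iter-pow r k x) (trans (cong (_⊕ x) pk) (sym eq)))

  TrivialIntersection : Carrier → Carrier → Set
  TrivialIntersection r r' = ∀ a → _∈⟨_⟩ G a r → _∈⟨_⟩ G a r' → a ≡ 𝟘

  orbits-meet-trivially : ∀ {r r' z z'} → TrivialIntersection r r' →
    Orbit r z z' → Orbit r' z z' → z ≡ z'
  orbits-meet-trivially {r} {r'} {z} trivial (a , refl) (c , eq) = begin
    z                 ≡⟨ sym (identityˡ z) ⟩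
    𝟘 ⊕ z             ≡⟨ cong (_⊕ z) (sym (trivial (pow G r a) (a , refl) (c , sym powers≡))) ⟩
    pow G r a ⊕ z     ≡⟨ sym (iter-pow r a z) ⟩
    iter G r a z      ∎
    where
    powers≡ : pow G r a ≡ pow G r' c
    powers≡ = ⊕-cancelʳ _ _ z (trans (sym (iter-pow r a z)) (trans (sym eq) (iter-pow r' c z)))

module LineGraph (G : Gyrogroup) (finite : Finite (Gyrogroup.Carrier G))
  (s t : Gyrogroup.Carrier G) (disjoint : GyrogroupProperties.TrivialIntersection G s t) where
  open Gyrogroup G
  open GyrogroupProperties G
  open Φ G s t

  gen-disjoint : ∀ {b b'} → ¬ b ≡ b' → TrivialIntersection (gen G s t b) (gen G s t b')
  gen-disjoint {true}  {true}  b≢b' = contradiction refl b≢b'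
  gen-disjoint {true}  {false} _    = disjoint
  gen-disjoint {false} {true}  _    = λ a a∈t a∈s → disjoint a a∈s a∈t
  gen-disjoint {false} {false} b≢b' = contradiction refl b≢b'

  ≈V-shared : ∀ {b x y z} → z ∈V (b , x) → z ∈V (b , y) → (b , x) ≈V (b , y)
  ≈V-shared zx zy = refl , orbit-trans zx (orbit-sym finite zy)

  simple : Simple
  simple (b , x) (b' , y) u≉v z z' zu zv z'u z'v with b ≟ b'
  ... | yes refl = contradiction (≈V-shared zu zv) u≉v
  ... | no b≢b'  =
    orbits-meet-trivially (gen-disjoint b≢b') (orbit-within finite zu z'u) (orbit-within finite zv z'v)

  edgeAt : Carrier → Edge
  edgeAt x = edge (true , x) (false , x) (λ { (() , _) }) (x , orbit-refl , orbit-refl)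

  edgeAt-injective : ∀ {x y} → edgeAt x ≈E edgeAt y → x ≡ y
  edgeAt-injective (inj₁ ((refl , ys) , (refl , yt))) = orbits-meet-trivially disjoint ys yt
  edgeAt-injective (inj₂ ((() , _) , _))

  edgeAt-≢ : ∀ {x y} → ¬ edgeAt x ≈E edgeAt y → ¬ x ≡ y
  edgeAt-≢ e≉e' refl = e≉e' (inj₁ ((refl , orbit-refl) , (refl , orbit-refl)))

  edgeAt-surjective : ∀ e → ∃ λ x → edgeAt x ≈E e
  edgeAt-surjective (edge (true , x) (true , y) u≉v (z , zu , zv)) =
    contradiction (≈V-shared zu zv) u≉v
  edgeAt-surjective (edge (false , x) (false , y) u≉v (z , zu , zv)) =
    contradiction (≈V-shared zu zv) u≉v
  edgeAt-surjective (edge (true , x) (false , y) _ (z , zu , zv)) =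
    z , inj₁ ((refl , orbit-sym finite zu) , (refl , orbit-sym finite zv))
  edgeAt-surjective (edge (false , x) (true , y) _ (z , zu , zv)) =
    z , inj₂ ((refl , orbit-sym finite zv) , (refl , orbit-sym finite zu))

  cay⇒line : ∀ x y → CayAdj x y → LAdj (edgeAt x) (edgeAt y)
  cay⇒line x y (x≢y , a , (inj₁ a∈s , _) , eq) =
    x≢y ∘ edgeAt-injective , inj₁ (refl , Equivalence.from orbit⇔coset (a , a∈s , eq))
  cay⇒line x y (x≢y , a , (inj₂ a∈t , _) , eq) =
    x≢y ∘ edgeAt-injective , inj₂ (inj₂ (inj₂ (refl , Equivalence.from orbit⇔coset (a , a∈t , eq))))

  cayAdj : ∀ {x y a} → ¬ x ≡ y → _∈⟨_⟩ G a s ⊎ _∈⟨_⟩ G a t → y ≡ a ⊕ x → CayAdj x y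
  cayAdj {x} {a = a} x≢y a∈s∪t eq = x≢y , a , (a∈s∪t , a≢𝟘) , eq
    where
    a≢𝟘 : ¬ a ≡ 𝟘
    a≢𝟘 refl = x≢y (sym (trans eq (identityˡ x)))

  line⇒cay : ∀ x y → LAdj (edgeAt x) (edgeAt y) → CayAdj x y
  line⇒cay x y (e≉e' , inj₁ (refl , xy))
    with a , a∈s , eq ← Equivalence.to orbit⇔coset xy = cayAdj (edgeAt-≢ e≉e') (inj₁ a∈s) eq
  line⇒cay x y (e≉e' , inj₂ (inj₁ (() , _)))
  line⇒cay x y (e≉e' , inj₂ (inj₂ (inj₁ (() , _))))
  line⇒cay x y (e≉e' , inj₂ (inj₂ (inj₂ (refl , xy))))
    with a , a∈t , eq ← Equivalence.to orbit⇔coset xy = cayAdj (edgeAt-≢ e≉e') (inj₂ a∈t) eq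

  cayIsoL : CayIsoL
  cayIsoL = record
    { f          = edgeAt
    ; injective  = λ _ _ → edgeAt-injective
    ; surjective = edgeAt-surjective
    ; adjacency  = λ x y → mk⇔ (cay⇒line x y) (line⇒cay x y)
    }

proposition2p17 : (G : Gyrogroup) → Finite (Gyrogroup.Carrier G) →
    (s t : Gyrogroup.Carrier G) →
    LeftGenerates₂ G s t →
    (∀ a → _∈⟨_⟩ G a s → _∈⟨_⟩ G a t → a ≡ Gyrogroup.𝟘 G) →
    Φ.Simple G s t × Φ.CayIsoL G s t
proposition2p17 G finite s t _ disjoint = simple , cayIsoL
  where open LineGraph G finite s t disjoint
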